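{- Let $P_1, P_2, P_3$ be relations such that $P_1$ is $\mathbf{CRC}$-healthy, $P_2$ is $\mathbf{CRR}$-healthy, $P_2$ does not refer to $st'$ (i.e. $P_2 = \exists st' \bullet P_2$), and $P_3$ is $\mathbf{CRF}$-healthy. Then the reactive contract $[P_1 \vdash P_2 \mid P_3]$ is $\mathbf{NCSP}$-healthy.
   Context: UTP setting: relations are predicates over undashed (initial) and dashed (final) variables; $;$ is relational composition, $\mathit{II}$ the relational identity, $P \lhd c \rhd Q = (c \wedge P) \vee (\neg c \wedge Q)$. Observational variables: booleans $ok,ok',wait,wait'$; traces $tr,tr'$ (finite event sequences; $\le$ prefix; $-$ removal of a prefix); state $st,st'$; refusal sets $ref, ref'$. $tt$ abbreviates $tr'-tr$. $\mathbf{R1}(P) = P \wedge tr \le tr'$; $\mathbf{R2}(P) = P[\langle\rangle, tr'-tr/tr,tr'] \lhd tr \le tr' \rhd P$; $\mathbf{RR}(P) = \exists ok,ok',wait,wait' \bullet \mathbf{R1}(\mathbf{R2}(P))$; $\mathbf{RC}(P) = \mathbf{R1}(\mathbf{RR}(P) ; (tr' \le tr))$; $\mathbf{CRR}(P) = \exists ref \bullet \mathbf{RR}(P)$; $\mathbf{CRF}(P) = \exists ref, ref' \bullet \mathbf{RR}(P)$; $\mathbf{CRC}(P) = \exists ref \bullet \mathbf{RC}(P)$; $P$ is $\mathbf{H}$-healthy iff $\mathbf{H}(P) = P$. $\mathit{true}_r = \mathbf{R1}(\mathit{true})$, $\neg_r P = \mathbf{R1}(\neg P)$, $P \Rightarrow_r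 Q = \neg_r P \vee Q$. $\mathit{II}_{srd} = ((\exists st \bullet \mathit{II}) \lhd wait \rhd \mathit{II}) \lhd ok \rhd (tr \le tr')$; $\mathbf{R3}_h(P) = \mathit{II}_{srd} \lhd wait \rhd P$; $[P_1 \vdash P_2 \mid P_3] = \mathbf{R1}(\mathbf{R2}(\mathbf{R3}_h(ok \wedge P_1 \Rightarrow ok' \wedge (P_2 \lhd wait' \rhd P_3))))$. $\mathit{Skip} = [\mathit{true}_r \vdash \mathit{false} \mid tt = \langle\rangle \wedge st' = st]$. $\mathbf{SRD1}(P) = ok \Rightarrow_r P$; $\mathbf{SRD3}(P) = P ; \mathit{II}_{srd}$; $\mathbf{NSRD} = \mathbf{SRD3}\circ\mathbf{SRD1}\circ\mathbf{R3}_h\circ\mathbf{R2}\circ\mathbf{R1}$; $\mathbf{CSP3}(P) = \mathit{Skip};P$; $\mathbf{CSP4}(P) = P;\mathit{Skip}$; $\mathbf{NCSP} = \mathbf{NSRD}\circ\mathbf{CSP3}\circ\mathbf{CSP4}$. -}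

module Defs where

open import Data.Bool using (Bool; true; false)
open import Data.List using (List; []; length; drop)
open import Data.List.Relation.Binary.Prefix.Heterogeneous using (Prefix)
open import Data.Product using (Σ; _×_; _,_)
open import Data.Sum using (_⊎_)
open import Data.Unit using (⊤)
open import Data.Empty using (⊥)
open import Relation.Nullary using (¬_)
open import Relation.Binary.PropositionalEquality using (_≡_)
open import Function using (_∘_)

-- Observation space (one copy: used for both undashed and dashed variables).
--   E : events, S : state space, R : type of refusal sets
record Obs (E S R : Set) : Set where
  field
    ok   : Bool
    wait : Bool
    tr   : List E
    st   : S
    ref  : R
open Obs public

variable
  E S R : Set

Rel : (E S R : Set) → Set₁
Rel E S R = Obs E S R → Obs E S R → Set

infix 4 _≐_
_≐_ : Rel E S R → Rel E S R → Set
P ≐ Q = ∀ s s' → (P s s' → Q s s') × (Q s s' → P s s')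

Healthy : (Rel E S R → Rel E S R) → Rel E S R → Set
Healthy H P = H P ≐ P

_≤t_ : List E → List E → Set
xs ≤t ys = Prefix _≡_ xs ys

_-t_ : List E → List E → List E
ys -t xs = drop (length xs) ys

trueR falseR : Rel E S R
trueR _ _ = ⊤
falseR _ _ = ⊥

_∧R_ _∨R_ _⇒R_ : Rel E S R → Rel E S R → Rel E S R
(P ∧R Q) s s' = P s s' × Q s s'
(P ∨R Q) s s' = P s s' ⊎ Q s s'
(P ⇒R Q) s s' = P s s' → Q s s'

notR : Rel E S R → Rel E S R
notR P s s' = ¬ P s s'

infixl 5 _⨟_
_⨟_ : Rel E S R → Rel E S R → Rel E S R
(P ⨟ Q) s s' = Σ (Obs _ _ _) λ m → P s m × Q m s'

II : Rel E S R
II s s' = s ≡ s'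

cond : Rel E S R → Rel E S R → Rel E S R → Rel E S R
cond P c Q = (c ∧R P) ∨R (notR c ∧R Q)

okC wait'C : Rel E S R
okC s _ = ok s ≡ true
wait'C _ s' = wait s' ≡ true
ok'C waitC : Rel E S R
ok'C _ s' = ok s' ≡ true
waitC s _ = wait s ≡ true

trLe trLe' : Rel E S R
trLe s s' = tr s ≤t tr s'
trLe' s s' = tr s' ≤t tr s

R1 : Rel E S R → Rel E S R
R1 P = P ∧R trLe

R2 : Rel E S R → Rel E S R
R2 P = cond (λ s s' → P (record s { tr = [] }) (record s' { tr = tr s' -t tr s })) trLe P

RR : Rel E S R → Rel E S R
RR P s s' = Σ Bool λ o → Σ Bool λ o' → Σ Bool λ w → Σ Bool λ w' →
  R1 (R2 P) (record s { ok = o ; wait = w }) (record s' { ok = o' ; wait = w' })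

RC : Rel E S R → Rel E S R
RC P = R1 (RR P ⨟ trLe')

CRR : Rel E S R → Rel E S R
CRR P s s' = Σ _ λ r → RR P (record s { ref = r }) s'

CRF : Rel E S R → Rel E S R
CRF P s s' = Σ _ λ r → Σ _ λ r' → RR P (record s { ref = r }) (record s' { ref = r' })

CRC : Rel E S R → Rel E S R
CRC P s s' = Σ _ λ r → RC P (record s { ref = r }) s'

exSt' : Rel E S R → Rel E S R
exSt' P s s' = Σ _ λ x → P s (record s' { st = x })

true-r : Rel E S R
true-r = R1 trueR

not-r : Rel E S R → Rel E S R
not-r P = R1 (notR P)

_⇒r_ : Rel E S R → Rel E S R → Rel E S R
P ⇒r Q = not-r P ∨R Q

IIsrd : Rel E S R
IIsrd = cond (cond (λ s s' → Σ _ λ x → II (record s { st = x }) s') waitC II) okC trLe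

R3h : Rel E S R → Rel E S R
R3h P = cond IIsrd waitC P

contract : Rel E S R → Rel E S R → Rel E S R → Rel E S R
contract P₁ P₂ P₃ = R1 (R2 (R3h ((okC ∧R P₁) ⇒R (ok'C ∧R cond P₂ wait'C P₃))))

Skip : Rel E S R
Skip = contract true-r falseR (λ s s' → ((tr s' -t tr s) ≡ []) × (st s' ≡ st s))

SRD1 SRD3 NSRD CSP3 CSP4 NCSP : Rel E S R → Rel E S R
SRD1 P = okC ⇒r P
SRD3 P = P ⨟ IIsrd
NSRD = SRD3 ∘ SRD1 ∘ R3h ∘ R2 ∘ R1
CSP3 P = Skip ⨟ P
CSP4 P = P ⨟ Skip
NCSP = NSRD ∘ CSP3 ∘ CSP4

-- A contract is R1-, R2-, R3h- and SRD1-healthy by construction.  From a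
-- stable start (ok ∧ ¬ wait) it only asserts a guarantee about the run with
-- the initial trace erased: if the precondition holds, the process has not
-- diverged and the peri- or postcondition holds.  Pre-composing Skip changes
-- only the initial refusal, which none of the three assertions observes
-- (CSP3).  Post-composing Skip keeps the trace but may change the final state
-- of a waiting process and the final refusal of a terminated one; the
-- guarantee survives because the precondition is prefix-closed (so it held
-- for the run up to the intermediate observation), the pericondition ignores
-- st' and the postcondition ignores ref' (CSP4).  Since IIsrd refines Skip,
-- CSP4 gives SRD3, and healthiness composes through monotone operators.
module Submission where

open import Defs
open import Level using (0ℓ)
open import Axiom.ExcludedMiddle using (ExcludedMiddle)
open import Data.Bool using (true; _≟_)
open import Data.Bool.Properties using (¬-not)
open import Data.List using (List; []; _∷_; length)
import Data.List.Relation.Binary.Pointwise as Pointwise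
open import Data.List.Relation.Binary.Prefix.Heterogeneous using ([]; _∷_)
open import Data.List.Relation.Binary.Prefix.Heterogeneous.Properties
  using (fromPointwise; drop⁺)
  renaming (trans to prefix-trans)
open import Data.Product using (Σ; _×_; _,_; proj₁; proj₂)
open import Data.Sum using (inj₁; inj₂)
open import Data.Empty using (⊥-elim)
open import Function using (_∘_)
open import Relation.Nullary using (yes; no)
open import Relation.Binary.PropositionalEquality
  using (_≡_; _≢_; refl; sym; trans; cong)

variable
  P Q : Rel E S R
  H G : Rel E S R → Rel E S R
  s s' : Obs E S R
  xs ys zs : List E

infix 4 _⊆_
_⊆_ : Rel E S R → Rel E S R → Set
P ⊆ Q = ∀ {s s'} → P s s' → Q s s'

⊆-antisym : P ⊆ Q → Q ⊆ P → P ≐ Q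
⊆-antisym P⊆Q Q⊆P _ _ = P⊆Q , Q⊆P

≐⇒⊆ : P ≐ Q → P ⊆ Q
≐⇒⊆ P≐Q = proj₁ (P≐Q _ _)

≐⇒⊇ : P ≐ Q → Q ⊆ P
≐⇒⊇ P≐Q = proj₂ (P≐Q _ _)

Monotone : (Rel E S R → Rel E S R) → Set₁
Monotone {E} {S} {R} H = {P Q : Rel E S R} → P ⊆ Q → H P ⊆ H Q

∘-monotone : Monotone H → Monotone G → Monotone (H ∘ G)
∘-monotone H-mono G-mono = H-mono ∘ G-mono

Healthy-∘ : Monotone H → Healthy H P → Healthy G P → Healthy (H ∘ G) P
Healthy-∘ H-mono H-P G-P =
  ⊆-antisym (≐⇒⊆ H-P ∘ H-mono (≐⇒⊆ G-P)) (H-mono (≐⇒⊇ G-P) ∘ ≐⇒⊇ H-P)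

R1-mono : Monotone {E} {S} {R} R1
R1-mono P⊆Q (p , le) = P⊆Q p , le

R2-mono : Monotone {E} {S} {R} R2
R2-mono P⊆Q (inj₁ (le , p)) = inj₁ (le , P⊆Q p)
R2-mono P⊆Q (inj₂ (n , p)) = inj₂ (n , P⊆Q p)

R3h-mono : Monotone {E} {S} {R} R3h
R3h-mono _ (inj₁ ii) = inj₁ ii
R3h-mono P⊆Q (inj₂ (n , p)) = inj₂ (n , P⊆Q p)

SRD1-mono : Monotone {E} {S} {R} SRD1
SRD1-mono _ (inj₁ ¬ok) = inj₁ ¬ok
SRD1-mono P⊆Q (inj₂ p) = inj₂ (P⊆Q p)

SRD3-mono : Monotone {E} {S} {R} SRD3
SRD3-mono P⊆Q (m , p , ii) = m , P⊆Q p , ii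

CSP3-mono : Monotone {E} {S} {R} CSP3
CSP3-mono P⊆Q (m , k , p) = m , k , P⊆Q p

NSRD-mono : Monotone {E} {S} {R} NSRD
NSRD-mono =
  ∘-monotone SRD3-mono
    (∘-monotone SRD1-mono (∘-monotone R3h-mono (∘-monotone R2-mono R1-mono)))

≤t-refl : (xs : List E) → xs ≤t xs
≤t-refl _ = fromPointwise (Pointwise.refl refl)

≤t-trans : xs ≤t ys → ys ≤t zs → xs ≤t zs
≤t-trans = prefix-trans trans

-t-self : (xs : List E) → xs -t xs ≡ []
-t-self [] = refl
-t-self (_ ∷ xs) = -t-self xs

-t≡[]⇒≡ : xs ≤t ys → ys -t xs ≡ [] → xs ≡ ys
-t≡[]⇒≡ {ys = []} [] _ = refl
-t≡[]⇒≡ {ys = _ ∷ _} [] ()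
-t≡[]⇒≡ (refl ∷ p) e = cong (_ ∷_) (-t≡[]⇒≡ p e)

Obs-≡ : {a b : Obs E S R} → ok a ≡ ok b → wait a ≡ wait b → tr a ≡ tr b →
  st a ≡ st b → ref a ≡ ref b → a ≡ b
Obs-≡ refl refl refl refl refl = refl

IIsrd-refl : (s : Obs E S R) → IIsrd s s
IIsrd-refl s with ok s ≟ true | wait s ≟ true
... | yes o | yes w = inj₁ (o , inj₁ (w , (st s , refl)))
... | yes o | no ¬w = inj₁ (o , inj₂ (¬w , refl))
... | no ¬o | _ = inj₂ (¬o , ≤t-refl (tr s))

-- (reset s , s' since s) is the run from s to s' as R2 presents it to the
-- assertions of a contract.
reset : Obs E S R → Obs E S R
reset s = record s { tr = [] }

_since_ : Obs E S R → Obs E S R → Obs E S R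
s' since s = record s' { tr = tr s' -t tr s }

Guarantee : Rel E S R → Rel E S R → Rel E S R → Rel E S R
Guarantee A B D = A ⇒R (ok'C ∧R cond B wait'C D)

module Contract {E S R : Set} (A B D : Rel E S R) where

  C : Rel E S R
  C = contract A B D

  tr-≤ : C s s' → tr s ≤t tr s'
  tr-≤ = proj₂

  abort : ok s ≢ true → tr s ≤t tr s' → C s s'
  abort {s = s} ¬o le with wait s ≟ true
  ... | yes w = inj₁ (le , inj₁ (w , inj₂ (¬o , []))) , le
  ... | no ¬w = inj₁ (le , inj₂ (¬w , λ (o , _) → ⊥-elim (¬o o))) , le

  wait-intro : {y : S} → ok s ≡ true → wait s ≡ true → C s (record s { st = y })
  wait-intro {s = s} {y = y} o w =
    inj₁ (≤t-refl (tr s) , inj₁ (w , inj₁ (o , inj₁ (w , (y , trace-erased)))))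
      , ≤t-refl (tr s)
    where
    trace-erased : record (reset s) { st = y } ≡ record s { st = y } since s
    trace-erased = cong (λ t → record s { st = y ; tr = t }) (sym (-t-self (tr s)))

  wait-elim : C s s' → ok s ≡ true → wait s ≡ true → Σ S λ y → record s { st = y } ≡ s'
  wait-elim (inj₁ (le , inj₁ (_ , inj₁ (_ , inj₁ (_ , (y , eq))))) , _) _ _ =
    y , Obs-≡ (cong ok eq) (cong wait eq) (-t≡[]⇒≡ le (sym (cong tr eq)))
              (cong st eq) (cong ref eq)
  wait-elim (inj₁ (_ , inj₁ (_ , inj₁ (_ , inj₂ (¬w , _)))) , _) _ w = ⊥-elim (¬w w)
  wait-elim (inj₁ (_ , inj₁ (_ , inj₂ (¬o , _))) , _) o _ = ⊥-elim (¬o o)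
  wait-elim (inj₁ (_ , inj₂ (¬w , _)) , _) _ w = ⊥-elim (¬w w)
  wait-elim (inj₂ (n , _) , le) _ _ = ⊥-elim (n le)

  run-intro : ok s ≡ true → wait s ≢ true → tr s ≤t tr s' →
    Guarantee A B D (reset s) (s' since s) → C s s'
  run-intro _ ¬w le g = inj₁ (le , inj₂ (¬w , λ (_ , a) → g a)) , le

  run-elim : C s s' → ok s ≡ true → wait s ≢ true →
    tr s ≤t tr s' × Guarantee A B D (reset s) (s' since s)
  run-elim (inj₁ (_ , inj₁ (w , _)) , _) _ ¬w = ⊥-elim (¬w w)
  run-elim (inj₁ (le , inj₂ (_ , g)) , _) o _ = le , λ a → g (o , a)
  run-elim (inj₂ (n , _) , le) _ _ = ⊥-elim (n le)

  R1-healthy : Healthy R1 C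
  R1-healthy = ⊆-antisym proj₁ (λ c → c , tr-≤ c)

  R2-healthy : Healthy R2 C
  R2-healthy = ⊆-antisym closed unfold
    where
    closed : R2 C ⊆ C
    closed (inj₁ (le , (inj₁ (_ , x) , _))) = inj₁ (le , x) , le
    closed (inj₁ (_ , (inj₂ (n , _) , _))) = ⊥-elim (n [])
    closed (inj₂ (n , c)) = ⊥-elim (n (tr-≤ c))
    unfold : C ⊆ R2 C
    unfold (inj₁ (le , x) , _) = inj₁ (le , (inj₁ ([] , x) , []))
    unfold (inj₂ (n , _) , le) = ⊥-elim (n le)

  R3h-healthy : Healthy R3h C
  R3h-healthy = ⊆-antisym closed unfold
    where
    closed : R3h C ⊆ C
    closed (inj₁ (w , inj₁ (o , inj₁ (_ , (_ , refl))))) = wait-intro o w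
    closed (inj₁ (w , inj₁ (_ , inj₂ (¬w , _)))) = ⊥-elim (¬w w)
    closed (inj₁ (_ , inj₂ (¬o , le))) = abort ¬o le
    closed (inj₂ (_ , c)) = c
    unfold : C ⊆ R3h C
    unfold {s} c with wait s ≟ true | ok s ≟ true
    ... | no ¬w | _ = inj₂ (¬w , c)
    ... | yes w | yes o = inj₁ (w , inj₁ (o , inj₁ (w , wait-elim c o w)))
    ... | yes w | no ¬o = inj₁ (w , inj₂ (¬o , tr-≤ c))

  SRD1-healthy : Healthy SRD1 C
  SRD1-healthy = ⊆-antisym closed inj₂
    where
    closed : SRD1 C ⊆ C
    closed (inj₁ (¬o , le)) = abort ¬o le
    closed (inj₂ c) = c

Skip-post : Rel E S R
Skip-post s s' = ((tr s' -t tr s) ≡ []) × (st s' ≡ st s)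

module _ {E S R : Set} where

  module Skip-contract = Contract {E} {S} {R} true-r falseR Skip-post

  Skip-refl : (s : Obs E S R) → Skip s s
  Skip-refl s with ok s ≟ true | wait s ≟ true
  ... | no ¬o | _ = Skip-contract.abort ¬o (≤t-refl (tr s))
  ... | yes o | yes w = Skip-contract.wait-intro o w
  ... | yes o | no ¬w =
    Skip-contract.run-intro o ¬w (≤t-refl (tr s))
      (λ _ → o , inj₂ (¬w , -t-self (tr s) , refl))

  Skip-stable : {s s' : Obs E S R} → Skip s s' → ok s ≡ true → wait s ≢ true →
    Σ R λ r → record s { ref = r } ≡ s'
  Skip-stable {s} {s'} k o ¬w with Skip-contract.run-elim k o ¬w
  ... | le , g with g (_ , [])
  ...   | _ , inj₁ (_ , ())
  ...   | o' , inj₂ (¬w' , tt≡[] , st≡) =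
    ref s' , Obs-≡ (trans o (sym o')) (trans (¬-not ¬w) (sym (¬-not ¬w')))
                   (-t≡[]⇒≡ le tt≡[]) (sym st≡) refl

  IIsrd⊆Skip : IIsrd ⊆ Skip
  IIsrd⊆Skip (inj₁ (o , inj₁ (w , (_ , refl)))) = Skip-contract.wait-intro o w
  IIsrd⊆Skip {s} (inj₁ (_ , inj₂ (_ , refl))) = Skip-refl s
  IIsrd⊆Skip (inj₂ (¬o , le)) = Skip-contract.abort ¬o le

InitialRefFree FinalRefFree FinalStFree PrefixClosed : Rel E S R → Set
InitialRefFree P = ∀ {s s'} r → P s s' → P (record s { ref = r }) s'
FinalRefFree P = ∀ {s s'} r → P s s' → P s (record s' { ref = r })
FinalStFree P = ∀ {s s'} x → P s s' → P s (record s' { st = x })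
PrefixClosed P = ∀ {s s' t'} → P s s' → tr s ≤t tr t' → tr t' ≤t tr s' → P s t'

CRC⇒InitialRefFree : Healthy CRC P → InitialRefFree P
CRC⇒InitialRefFree CRC-P {s} {s'} _ p = proj₁ (CRC-P _ s') (proj₂ (CRC-P s s') p)

CRC⇒PrefixClosed : Healthy CRC P → PrefixClosed P
CRC⇒PrefixClosed CRC-P {s} {s'} {t'} p le le' with proj₂ (CRC-P s s') p
... | r , ((m , rr , s'≤m) , _) =
  proj₁ (CRC-P s t') (r , ((m , rr , ≤t-trans le' s'≤m) , le))

CRR⇒InitialRefFree : Healthy CRR P → InitialRefFree P
CRR⇒InitialRefFree CRR-P {s} {s'} _ p = proj₁ (CRR-P _ s') (proj₂ (CRR-P s s') p)

CRF⇒InitialRefFree : Healthy CRF P → InitialRefFree P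
CRF⇒InitialRefFree CRF-P {s} {s'} _ p = proj₁ (CRF-P _ s') (proj₂ (CRF-P s s') p)

CRF⇒FinalRefFree : Healthy CRF P → FinalRefFree P
CRF⇒FinalRefFree CRF-P {s} {s'} _ p = proj₁ (CRF-P s _) (proj₂ (CRF-P s s') p)

exSt'⇒FinalStFree : P ≐ exSt' P → FinalStFree P
exSt'⇒FinalStFree P≐∃st' {s} {s'} _ p = proj₂ (P≐∃st' s _) (st s' , p)

module _ {P₁ P₂ P₃ : Rel E S R} (P₁-ref : InitialRefFree P₁)
  (P₂-ref : InitialRefFree P₂) (P₃-ref : InitialRefFree P₃) where

  guarantee-initial-ref : ∀ {r} → Guarantee P₁ P₂ P₃ (record s { ref = r }) s' →
    Guarantee P₁ P₂ P₃ s s'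
  guarantee-initial-ref {s = s} g p₁ with g (P₁-ref _ p₁)
  ... | o' , inj₁ (w' , p₂) = o' , inj₁ (w' , P₂-ref (ref s) p₂)
  ... | o' , inj₂ (¬w' , p₃) = o' , inj₂ (¬w' , P₃-ref (ref s) p₃)

  private module C = Contract P₁ P₂ P₃

  contract-CSP3 : Healthy CSP3 (contract P₁ P₂ P₃)
  contract-CSP3 = ⊆-antisym closed (λ {s} c → s , Skip-refl s , c)
    where
    closed : CSP3 (contract P₁ P₂ P₃) ⊆ contract P₁ P₂ P₃
    closed {s} (_ , k , c) with ok s ≟ true | wait s ≟ true
    ... | no ¬o | _ = C.abort ¬o (≤t-trans (Skip-contract.tr-≤ k) (C.tr-≤ c))
    ... | yes o | yes w with Skip-contract.wait-elim k o w
    ...   | _ , refl with C.wait-elim c o w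
    ...     | _ , refl = C.wait-intro o w
    closed {s} (_ , k , c) | yes o | no ¬w with Skip-stable k o ¬w
    ...   | _ , refl with C.run-elim c o ¬w
    ...     | le , g = C.run-intro o ¬w le (guarantee-initial-ref {s = reset s} g)

module _ {P₁ P₂ P₃ : Rel E S R} (P₁-prefix : PrefixClosed P₁)
  (P₂-st' : FinalStFree P₂) (P₃-ref' : FinalRefFree P₃) where

  guarantee-⨟Skip : {b : Obs E S R} → Skip b s' →
    Guarantee P₁ P₂ P₃ (reset s) (b since s) →
    Guarantee P₁ P₂ P₃ (reset s) (s' since s)
  guarantee-⨟Skip {s = s} k g p₁
    with g (P₁-prefix p₁ [] (drop⁺ (length (tr s)) (Skip-contract.tr-≤ k)))
  ... | ob , inj₁ (wb , p₂) with Skip-contract.wait-elim k ob wb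
  ...   | y , refl = ob , inj₁ (wb , P₂-st' y p₂)
  guarantee-⨟Skip k g p₁ | ob , inj₂ (¬wb , p₃) with Skip-stable k ob ¬wb
  ...   | r , refl = ob , inj₂ (¬wb , P₃-ref' r p₃)

  private module C = Contract P₁ P₂ P₃

  contract-CSP4 : Healthy CSP4 (contract P₁ P₂ P₃)
  contract-CSP4 = ⊆-antisym closed (λ {_} {s'} c → s' , c , Skip-refl s')
    where
    closed : CSP4 (contract P₁ P₂ P₃) ⊆ contract P₁ P₂ P₃
    closed {s} (_ , c , k) with ok s ≟ true | wait s ≟ true
    ... | no ¬o | _ = C.abort ¬o (≤t-trans (C.tr-≤ c) (Skip-contract.tr-≤ k))
    ... | yes o | yes w with C.wait-elim c o w
    ...   | _ , refl with Skip-contract.wait-elim k o w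
    ...     | _ , refl = C.wait-intro o w
    closed {s} (_ , c , k) | yes o | no ¬w with C.run-elim c o ¬w
    ...   | le , g =
      C.run-intro o ¬w (≤t-trans le (Skip-contract.tr-≤ k)) (guarantee-⨟Skip {s = s} k g)

  contract-SRD3 : Healthy SRD3 (contract P₁ P₂ P₃)
  contract-SRD3 =
    ⊆-antisym (λ (m , c , ii) → ≐⇒⊆ contract-CSP4 (m , c , IIsrd⊆Skip ii))
              (λ {_} {s'} c → s' , c , IIsrd-refl s')

  contract-NSRD : Healthy NSRD (contract P₁ P₂ P₃)
  contract-NSRD =
    Healthy-∘ {G = SRD1 ∘ R3h ∘ R2 ∘ R1} SRD3-mono contract-SRD3
      (Healthy-∘ {G = R3h ∘ R2 ∘ R1} SRD1-mono C.SRD1-healthy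
        (Healthy-∘ {G = R2 ∘ R1} R3h-mono C.R3h-healthy
          (Healthy-∘ {G = R1} R2-mono C.R2-healthy C.R1-healthy)))

-- Excluded middle is not needed: every case split is on the booleans ok and wait.
theorem12 : {E S R : Set} → ExcludedMiddle 0ℓ →
    (P₁ P₂ P₃ : Rel E S R) →
    Healthy CRC P₁ → Healthy CRR P₂ → P₂ ≐ exSt' P₂ → Healthy CRF P₃ →
    Healthy NCSP (contract P₁ P₂ P₃)
theorem12 _ P₁ P₂ P₃ CRC-P₁ CRR-P₂ P₂≐∃st' CRF-P₃ =
  Healthy-∘ {G = CSP3 ∘ CSP4} NSRD-mono (contract-NSRD P₁-prefix P₂-st' P₃-ref')
    (Healthy-∘ {G = CSP4} CSP3-mono (contract-CSP3 P₁-ref P₂-ref P₃-ref)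
      (contract-CSP4 P₁-prefix P₂-st' P₃-ref'))
  where
  P₁-prefix : PrefixClosed P₁
  P₁-prefix = CRC⇒PrefixClosed CRC-P₁
  P₂-st' : FinalStFree P₂
  P₂-st' = exSt'⇒FinalStFree P₂≐∃st'
  P₃-ref' : FinalRefFree P₃
  P₃-ref' = CRF⇒FinalRefFree CRF-P₃
  P₁-ref : InitialRefFree P₁
  P₁-ref = CRC⇒InitialRefFree CRC-P₁
  P₂-ref : InitialRefFree P₂
  P₂-ref = CRR⇒InitialRefFree CRR-P₂
  P₃-ref : InitialRefFree P₃
  P₃-ref = CRF⇒InitialRefFree CRF-P₃
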